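{- $\gamma^{L\text{ - }ID}(\mathcal{T})=\frac{1}{4}=\gamma^{ID}(\mathcal{T})$.
   Context: The triangular grid $\mathcal{T}$ has vertex set $\mathbb{Z}^2$, with $\mathbf{u},\mathbf{v}$ adjacent iff $\mathbf{u}-\mathbf{v}\in\{(\pm1,0),(0,\pm1),(1,1),(-1,-1)\}$. For a vertex $u$, $N[u]$ is its closed neighbourhood; for a code (nonempty vertex subset) $C$, $I_C(u)=N[u]\cap C$. $C$ is a covering code if $I_C(u)\neq\emptyset$ for all $u$; an identifying code if it is covering and $I_C(u)\neq I_C(v)$ for all distinct $u,v$; a local identifying code if it is covering and $I_C(u)\neq I_C(v)$ for all adjacent $u,v$. The density of $C\subseteq\mathbb{Z}^2$ is $D(C)=\limsup_{n\to\infty}\frac{|C\cap Q_n|}{|Q_n|}$ with $Q_n=\{(i,j)\in\mathbb{Z}^2: |i|\leq n,|j|\leq n\}$. $\gamma^{L\text{ - }ID}(\mathcal{T})$ and $\gamma^{ID}(\mathcal{T})$ are the smallest densities of local identifying and identifying codes in $\mathcal{T}$, respectively. -}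

module Defs where

open import Data.Bool using (Bool; true; false; if_then_else_)
open import Data.Nat as ℕ using (ℕ; suc)
open import Data.Integer as ℤ using (ℤ; +_; -[1+_])
open import Data.Rational as ℚ using (ℚ)
open import Data.List using (List; []; _∷_; map; upTo; concatMap)
open import Data.Nat.ListAction using (sum)
open import Data.List.Membership.Propositional using (_∈_)
open import Data.Product using (_×_; _,_; ∃)
open import Data.Sum using (_⊎_)
open import Data.Empty using (⊥)
open import Relation.Nullary using (¬_)
open import Relation.Binary.PropositionalEquality using (_≡_)
open import Function.Bundles using (_⇔_)

-- Vertices of the triangular grid: ℤ².
V : Set
V = ℤ × ℤ

Code : Set
Code = V → Bool

_∈C_ : V → Code → Set
u ∈C C = C u ≡ true

steps : List V
steps = (+ 1 , + 0) ∷ (-[1+ 0 ] , + 0) ∷ (+ 0 , + 1) ∷ (+ 0 , -[1+ 0 ])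
      ∷ (+ 1 , + 1) ∷ (-[1+ 0 ] , -[1+ 0 ]) ∷ []

_-V_ : V → V → V
(a , b) -V (c , d) = (a ℤ.- c , b ℤ.- d)

Adj : V → V → Set
Adj u v = (u -V v) ∈ steps

InN : V → V → Set
InN u w = (w ≡ u) ⊎ Adj u w

InI : Code → V → V → Set
InI C u w = InN u w × (w ∈C C)

SameI : Code → V → V → Set
SameI C u v = ∀ w → InI C u w ⇔ InI C v w

NonemptyCode : Code → Set
NonemptyCode C = ∃ λ w → w ∈C C

IsCovering : Code → Set
IsCovering C = NonemptyCode C × (∀ u → ∃ λ w → InI C u w)

IsIdentifying : Code → Set
IsIdentifying C = IsCovering C × (∀ u v → ¬ (u ≡ v) → ¬ SameI C u v)

IsLocalIdentifying : Code → Set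
IsLocalIdentifying C = IsCovering C × (∀ u v → Adj u v → ¬ SameI C u v)

range : ℕ → List ℤ
range n = map (λ k → + k ℤ.- + n) (upTo (suc (n ℕ.+ n)))

count : Code → ℕ → ℕ
count C n = sum (concatMap (λ i → map (λ j → if C (i , j) then 1 else 0) (range n)) (range n))

-- |Q_n| = (2n+1)² = suc (4n² + 4n)
Qsize : ℕ → ℕ
Qsize n = suc (4 ℕ.* n ℕ.* n ℕ.+ 4 ℕ.* n)

ratio : Code → ℕ → ℚ
ratio C n = (+ count C n) ℚ./ Qsize n

-- limsup_{n→∞} ratio C n ≥ q
DensityGeq : Code → ℚ → Set
DensityGeq C q = ∀ (ε : ℚ) → ℚ.0ℚ ℚ.< ε → ∀ (N : ℕ) → ∃ λ n → N ℕ.≤ n × (q ℚ.- ε ℚ.< ratio C n)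

-- limsup_{n→∞} ratio C n ≤ q
DensityLeq : Code → ℚ → Set
DensityLeq C q = ∀ (ε : ℚ) → ℚ.0ℚ ℚ.< ε → ∃ λ N → ∀ n → N ℕ.≤ n → ratio C n ℚ.< q ℚ.+ ε

DensityEq : Code → ℚ → Set
DensityEq C q = DensityLeq C q × DensityGeq C q

SmallestDensity : (Code → Set) → ℚ → Set
SmallestDensity P q = (∃ λ C → P C × DensityEq C q) × (∀ C → P C → DensityGeq C q)

quarter : ℚ
quarter = + 1 ℚ./ 4

-- Lower bound by discharging. Every vertex y hands 1/|I(y)| to each codeword of I(y), which is nonempty and has
-- at most 7 elements. For a local identifying code a codeword c receives Σ_{y ∈ N[c]} 1/|I(y)| ≤ 4: c must be
-- separated from each of its neighbours, and adjacent neighbours from each other, which forces further codewords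
-- around c. Up to rotation the six neighbours of c look alike, and what remains is a finite check over which
-- neighbours are codewords and which of the three outer vertices of each neighbour meet the code. Summing over
-- Q_n gives |Q_n| ≤ 4 |C ∩ Q_(n+1)|.
--
-- Upper bound: the vertices with both coordinates even form an identifying code of density 1/4. Codewords are
-- pairwise non-adjacent, and every other vertex is the midpoint of two codewords of its neighbourhood, which no
-- other vertex has both in its neighbourhood.

module Submission where

open import Data.Bool using (Bool; true; false; if_then_else_; _∧_; _∨_; not; T)
open import Data.Bool.ListAction using (or; any; all)
open import Data.Bool.Properties using (T-∧; not-involutive)
open import Data.Empty using (⊥; ⊥-elim)
open import Data.Fin using (Fin; toℕ)
open import Data.Fin.Patterns using (0F; 1F; 2F; 3F; 4F; 5F)
open import Data.Fin.Properties using (all?)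
open import Data.Integer as ℤ using (ℤ; +_; -[1+_]; +[1+_]; +<+)
import Data.Integer.Properties as ℤP
open import Data.Integer.Tactic.RingSolver using (solve-∀)
open import Data.List using (List; []; _∷_; map; applyUpTo; concatMap; concat; tabulate; allFin)
open import Data.List.Membership.Propositional using (_∈_)
open import Data.List.Properties using (map-cong)
open import Data.List.Relation.Unary.All as All using (All; []; _∷_)
open import Data.List.Relation.Unary.All.Properties using (all⁻; tabulate⁺; ++⁺)
open import Data.List.Relation.Unary.Any using (here; there)
open import Data.Nat using (ℕ; zero; suc; _+_; _*_; _≤_; _<_; _≤ᵇ_; z≤n; s≤s)
open import Data.Nat.Coprimality using (Coprime)
open import Data.Nat.ListAction using (sum)
open import Data.Nat.ListAction.Properties using (sum-++)
open import Data.Nat.Properties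
  using (+-comm; +-assoc; +-identityʳ; +-suc; *-comm; *-assoc; *-zeroʳ; *-distribˡ-+; *-distribʳ-+;
         +-mono-≤; +-monoʳ-≤; +-monoʳ-<; +-mono-≤-<; *-mono-≤; *-monoˡ-≤; *-monoʳ-≤; *-monoʳ-<; *-cancelˡ-≤;
         m≤m+n; m≤n+m; n≤1+n; ≤-refl; ≤-trans; ≤-reflexive; ≤-<-trans; ≤ᵇ⇒≤; module ≤-Reasoning)
import Data.Nat.Tactic.RingSolver as ℕ-Solver
open import Data.Product using (_×_; _,_; proj₁; proj₂; ∃; ∃-syntax)
open import Data.Product.Properties using (≡-dec)
open import Data.Rational as ℚ using (mkℚ; *<*)
import Data.Rational.Properties as ℚP
open import Data.Rational.Unnormalised as ℚᵘ using (mkℚᵘ)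
import Data.Rational.Unnormalised.Properties as ℚᵘP
open import Data.Sum using (_⊎_; inj₁; inj₂)
open import Data.Vec using (Vec; lookup) renaming ([] to []ᵛ; _∷_ to _∷ᵛ_; tabulate to tabulateᵛ)
open import Function using (_∘_)
open import Function.Bundles using (Equivalence; mk⇔)
open import Relation.Binary.Definitions using (DecidableEquality)
open import Relation.Binary.PropositionalEquality
open import Relation.Nullary using (¬_)
open import Relation.Nullary.Decidable using (Dec; True; toWitness; from-yes; from-no; _×-dec_; _⊎-dec_; _→-dec_)

open import Defs

_+V_ : V → V → V
(a , b) +V (c , d) = (a ℤ.+ c , b ℤ.+ d)

origin : V
origin = (+ 0 , + 0)

negV : V → V
negV (a , b) = (ℤ.- a , ℤ.- b)

-- Rotation by 60° about the origin; it maps the triangular grid onto itself.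
rot : V → V
rot (x , y) = (x ℤ.- y , x)

rot^ : ℕ → V → V
rot^ zero u = u
rot^ (suc k) u = rot (rot^ k u)

_≟V_ : DecidableEquality V
_≟V_ = ≡-dec ℤ._≟_ ℤ._≟_

open import Data.List.Membership.DecPropositional _≟V_ using (_∈?_)

+V-identityʳ : ∀ u → u +V origin ≡ u
+V-identityʳ (a , b) = cong₂ _,_ (ℤP.+-identityʳ a) (ℤP.+-identityʳ b)

+V-assoc : ∀ u v w → (u +V v) +V w ≡ u +V (v +V w)
+V-assoc (a , b) (c , d) (e , f) = cong₂ _,_ (ℤP.+-assoc a c e) (ℤP.+-assoc b d f)

[c+u]-[c+v]≡u-v : ∀ c u v → (c +V u) -V (c +V v) ≡ u -V v
[c+u]-[c+v]≡u-v (c , c′) (a , a′) (b , b′) = cong₂ _,_ (coordinate c a b) (coordinate c′ a′ b′)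
  where
  coordinate : ∀ c a b → (c ℤ.+ a) ℤ.- (c ℤ.+ b) ≡ a ℤ.- b
  coordinate = solve-∀

w≡u+-[u-w] : ∀ u w → w ≡ u +V negV (u -V w)
w≡u+-[u-w] (a , a′) (b , b′) = cong₂ _,_ (coordinate a b) (coordinate a′ b′)
  where
  coordinate : ∀ a b → b ≡ a ℤ.+ ℤ.- (a ℤ.- b)
  coordinate = solve-∀

u-[u+s]≡-s : ∀ u s → u -V (u +V s) ≡ negV s
u-[u+s]≡-s (a , a′) (b , b′) = cong₂ _,_ (coordinate a b) (coordinate a′ b′)
  where
  coordinate : ∀ a s → a ℤ.- (a ℤ.+ s) ≡ ℤ.- s
  coordinate = solve-∀

[c+v]+[k-v]≡c+k : ∀ c v k → (c +V v) +V (k -V v) ≡ c +V k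
[c+v]+[k-v]≡c+k (c , c′) (v , v′) (k , k′) = cong₂ _,_ (coordinate c v k) (coordinate c′ v′ k′)
  where
  coordinate : ∀ c v k → (c ℤ.+ v) ℤ.+ (k ℤ.- v) ≡ c ℤ.+ k
  coordinate = solve-∀

u+d≡v+s⇒v≡u+[d-s] : ∀ u d v s → u +V d ≡ v +V s → v ≡ u +V (d -V s)
u+d≡v+s⇒v≡u+[d-s] (a , a′) (d , d′) (b , b′) (s , s′) eq =
  cong₂ _,_ (coordinate a d b s (cong proj₁ eq)) (coordinate a′ d′ b′ s′ (cong proj₂ eq))
  where
  coordinate : ∀ a d b s → a ℤ.+ d ≡ b ℤ.+ s → b ≡ a ℤ.+ (d ℤ.- s)
  coordinate a d b s eq = trans (identity b s) (trans (cong (ℤ._- s) (sym eq)) (regroup a d s))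
    where
    identity : ∀ b s → b ≡ (b ℤ.+ s) ℤ.- s
    identity = solve-∀
    regroup : ∀ a d s → (a ℤ.+ d) ℤ.- s ≡ a ℤ.+ (d ℤ.- s)
    regroup = solve-∀

+V-cancelˡ : ∀ u x y → u +V x ≡ u +V y → x ≡ y
+V-cancelˡ (a , a′) (x , x′) (y , y′) eq =
  cong₂ _,_ (coordinate a x y (cong proj₁ eq)) (coordinate a′ x′ y′ (cong proj₂ eq))
  where
  coordinate : ∀ a x y → a ℤ.+ x ≡ a ℤ.+ y → x ≡ y
  coordinate a x y eq = trans (identity a x) (trans (cong (ℤ._+_ (ℤ.- a)) eq) (sym (identity a y)))
    where
    identity : ∀ a x → x ≡ ℤ.- a ℤ.+ (a ℤ.+ x)
    identity = solve-∀

rot-+V : ∀ u v → rot (u +V v) ≡ rot u +V rot v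
rot-+V (a , a′) (b , b′) = cong₂ _,_ (coordinate a a′ b b′) refl
  where
  coordinate : ∀ a a′ b b′ → (a ℤ.+ b) ℤ.- (a′ ℤ.+ b′) ≡ (a ℤ.- a′) ℤ.+ (b ℤ.- b′)
  coordinate = solve-∀

[u+v]+rot³v≡u : ∀ u v → (u +V v) +V rot^ 3 v ≡ u
[u+v]+rot³v≡u (a , a′) (b , b′) = cong₂ _,_ (first a b b′) (second a′ b b′)
  where
  first : ∀ a b b′ → (a ℤ.+ b) ℤ.+ (((b ℤ.- b′) ℤ.- b) ℤ.- (b ℤ.- b′)) ≡ a
  first = solve-∀
  second : ∀ a′ b b′ → (a′ ℤ.+ b′) ℤ.+ ((b ℤ.- b′) ℤ.- b) ≡ a′
  second = solve-∀

rot^-origin : ∀ k → rot^ k origin ≡ origin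
rot^-origin zero = refl
rot^-origin (suc k) rewrite rot^-origin k = refl

χ : Bool → ℕ
χ true = 1
χ false = 0

χ≤1 : ∀ b → χ b ≤ 1
χ≤1 true = s≤s z≤n
χ≤1 false = z≤n

sum-map-cong : ∀ {A : Set} {f g : A → ℕ} xs → (∀ x → f x ≡ g x) → sum (map f xs) ≡ sum (map g xs)
sum-map-cong xs eq = cong sum (map-cong eq xs)

sum-map-mono : ∀ {A : Set} {f g : A → ℕ} xs → (∀ x → x ∈ xs → f x ≤ g x) →
               sum (map f xs) ≤ sum (map g xs)
sum-map-mono [] le = z≤n
sum-map-mono (x ∷ xs) le = +-mono-≤ (le x (here refl)) (sum-map-mono xs (λ y y∈ → le y (there y∈)))

sum-map-*ʳ : ∀ {A : Set} (f : A → ℕ) xs k → sum (map f xs) * k ≡ sum (map (λ x → f x * k) xs)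
sum-map-*ʳ f [] k = refl
sum-map-*ʳ f (x ∷ xs) k = trans (*-distribʳ-+ k (f x) _) (cong (_+_ (f x * k)) (sum-map-*ʳ f xs k))

sum-map-*ˡ : ∀ {A : Set} (f : A → ℕ) xs k → k * sum (map f xs) ≡ sum (map (λ x → k * f x) xs)
sum-map-*ˡ f [] k = *-zeroʳ k
sum-map-*ˡ f (x ∷ xs) k = trans (*-distribˡ-+ k (f x) _) (cong (_+_ (k * f x)) (sum-map-*ˡ f xs k))

sum-map-∈ : ∀ {A : Set} (f : A → ℕ) {xs x} → x ∈ xs → f x ≤ sum (map f xs)
sum-map-∈ f (here refl) = m≤m+n _ _
sum-map-∈ f {y ∷ _} (there x∈) = ≤-trans (sum-map-∈ f x∈) (m≤n+m _ (f y))

sum-concatMap : ∀ {A : Set} (f : A → List ℕ) xs → sum (concatMap f xs) ≡ sum (map (λ x → sum (f x)) xs)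
sum-concatMap f [] = refl
sum-concatMap f (x ∷ xs) = trans (sum-++ (f x) (concatMap f xs)) (cong (_+_ (sum (f x))) (sum-concatMap f xs))

sumFrom : ℤ → ℕ → (ℤ → ℕ) → ℕ
sumFrom a zero g = 0
sumFrom a (suc m) g = g a + sumFrom (a ℤ.+ + 1) m g

sumFrom-cong : ∀ m a {g k : ℤ → ℕ} → (∀ i → g i ≡ k i) → sumFrom a m g ≡ sumFrom a m k
sumFrom-cong zero a eq = refl
sumFrom-cong (suc m) a eq = cong₂ _+_ (eq a) (sumFrom-cong m (a ℤ.+ + 1) eq)

sumFrom-mono : ∀ m a {g k : ℤ → ℕ} → (∀ i → g i ≤ k i) → sumFrom a m g ≤ sumFrom a m k
sumFrom-mono zero a le = z≤n
sumFrom-mono (suc m) a le = +-mono-≤ (le a) (sumFrom-mono m (a ℤ.+ + 1) le)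

sumFrom-+ : ∀ m a (g k : ℤ → ℕ) → sumFrom a m (λ i → g i + k i) ≡ sumFrom a m g + sumFrom a m k
sumFrom-+ zero a g k = refl
sumFrom-+ (suc m) a g k rewrite sumFrom-+ m (a ℤ.+ + 1) g k = interchange (g a) (k a) _ _
  where
  interchange : ∀ w x y z → (w + x) + (y + z) ≡ (w + y) + (x + z)
  interchange = ℕ-Solver.solve-∀

sumFrom-* : ∀ m a c (g : ℤ → ℕ) → sumFrom a m (λ i → c * g i) ≡ c * sumFrom a m g
sumFrom-* zero a c g = sym (*-zeroʳ c)
sumFrom-* (suc m) a c g rewrite sumFrom-* m (a ℤ.+ + 1) c g = sym (*-distribˡ-+ c (g a) _)

sumFrom-const : ∀ m a c → sumFrom a m (λ _ → c) ≡ m * c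
sumFrom-const zero a c = refl
sumFrom-const (suc m) a c = cong (_+_ c) (sumFrom-const m _ c)

sumFrom-shift : ∀ m a δ g → sumFrom a m (λ i → g (i ℤ.+ δ)) ≡ sumFrom (a ℤ.+ δ) m g
sumFrom-shift zero a δ g = refl
sumFrom-shift (suc m) a δ g =
  cong (_+_ (g (a ℤ.+ δ))) (trans (sumFrom-shift m (a ℤ.+ + 1) δ g) (cong (λ b → sumFrom b m g) (comm a δ)))
  where
  comm : ∀ a δ → (a ℤ.+ + 1) ℤ.+ δ ≡ (a ℤ.+ δ) ℤ.+ + 1
  comm = solve-∀

sumFrom-prefix : ∀ m k a g → sumFrom a m g ≤ sumFrom a (m + k) g
sumFrom-prefix zero k a g = z≤n
sumFrom-prefix (suc m) k a g = +-monoʳ-≤ (g a) (sumFrom-prefix m k (a ℤ.+ + 1) g)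

data Small : ℤ → Set where
  neg : Small -[1+ 0 ]
  nil : Small (+ 0)
  pos : Small (+ 1)

sumFrom-window : ∀ m b g δ → Small δ → sumFrom ((b ℤ.+ + 1) ℤ.+ δ) m g ≤ sumFrom b (suc (suc m)) g
sumFrom-window m b g .(-[1+ 0 ]) neg =
  subst₂ (λ a k → sumFrom a m g ≤ sumFrom b k g) (sym (back b)) (+-comm m 2) (sumFrom-prefix m 2 b g)
  where
  back : ∀ b → (b ℤ.+ + 1) ℤ.+ -[1+ 0 ] ≡ b
  back = solve-∀
sumFrom-window m b g .(+ 0) nil rewrite ℤP.+-identityʳ (b ℤ.+ + 1) =
  ≤-trans (subst (λ k → sumFrom (b ℤ.+ + 1) m g ≤ sumFrom (b ℤ.+ + 1) k g) (+-comm m 1)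
                 (sumFrom-prefix m 1 (b ℤ.+ + 1) g))
          (m≤n+m _ (g b))
sumFrom-window m b g .(+ 1) pos = ≤-trans (m≤n+m _ (g (b ℤ.+ + 1))) (m≤n+m _ (g b))

side : ℕ → ℕ
side n = suc (n + n)

corner : ℕ → ℤ
corner n = ℤ.- (+ n)

box : ℕ → (V → ℕ) → ℕ
box n F = sumFrom (corner n) (side n) (λ i → sumFrom (corner n) (side n) (λ j → F (i , j)))

box-cong : ∀ n {F G : V → ℕ} → (∀ v → F v ≡ G v) → box n F ≡ box n G
box-cong n eq = sumFrom-cong (side n) (corner n) (λ i → sumFrom-cong (side n) (corner n) (λ j → eq (i , j)))

box-mono : ∀ n {F G : V → ℕ} → (∀ v → F v ≤ G v) → box n F ≤ box n G
box-mono n le = sumFrom-mono (side n) (corner n) (λ i → sumFrom-mono (side n) (corner n) (λ j → le (i , j)))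

box-+ : ∀ n (F G : V → ℕ) → box n (λ v → F v + G v) ≡ box n F + box n G
box-+ n F G = trans
  (sumFrom-cong (side n) (corner n) (λ i → sumFrom-+ (side n) (corner n) (λ j → F (i , j)) (λ j → G (i , j))))
  (sumFrom-+ (side n) (corner n) (λ i → sumFrom (corner n) (side n) (λ j → F (i , j)))
                                  (λ i → sumFrom (corner n) (side n) (λ j → G (i , j))))

box-* : ∀ n c (F : V → ℕ) → box n (λ v → c * F v) ≡ c * box n F
box-* n c F = trans
  (sumFrom-cong (side n) (corner n) (λ i → sumFrom-* (side n) (corner n) c (λ j → F (i , j))))
  (sumFrom-* (side n) (corner n) c (λ i → sumFrom (corner n) (side n) (λ j → F (i , j))))

box-const : ∀ n c → box n (λ _ → c) ≡ side n * (side n * c)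
box-const n c = trans (sumFrom-cong (side n) (corner n) (λ i → sumFrom-const (side n) (corner n) c))
                      (sumFrom-const (side n) (corner n) _)

sumFrom-window-suc : ∀ n g δ → Small δ →
                     sumFrom (corner n ℤ.+ δ) (side n) g ≤ sumFrom (corner (suc n)) (side (suc n)) g
sumFrom-window-suc n g δ u =
  subst₂ (λ a k → sumFrom (a ℤ.+ δ) (side n) g ≤ sumFrom (corner (suc n)) k g)
         (sym (corner-suc n)) (sym (cong (λ x → suc (suc x)) (+-suc n n)))
         (sumFrom-window (side n) (corner (suc n)) g δ u)
  where
  corner-suc : ∀ n → corner n ≡ corner (suc n) ℤ.+ + 1
  corner-suc zero = refl
  corner-suc (suc n) = refl

box-shift : ∀ n F d₁ d₂ → Small d₁ → Small d₂ → box n (λ v → F (v +V (d₁ , d₂))) ≤ box (suc n) F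
box-shift n F d₁ d₂ u₁ u₂ = ≤-trans
  (sumFrom-mono (side n) (corner n) (λ i →
     ≤-trans (≤-reflexive (sumFrom-shift (side n) (corner n) d₂ (λ j → F (i ℤ.+ d₁ , j))))
             (sumFrom-window-suc n (λ j → F (i ℤ.+ d₁ , j)) d₂ u₂)))
  (≤-trans (≤-reflexive (sumFrom-shift (side n) (corner n) d₁ row))
           (sumFrom-window-suc n row d₁ u₁))
  where
  row : ℤ → ℕ
  row i = sumFrom (corner (suc n)) (side (suc n)) (λ j → F (i , j))

sum-range : ∀ n (g : ℤ → ℕ) → sum (map g (range n)) ≡ sumFrom (corner n) (side n) g
sum-range n g = go (side n) (corner n) (λ k → k) (λ k → ℤP.+-comm (+ k) (ℤ.- (+ n)))
  where
  go : ∀ m a (ψ : ℕ → ℕ) → (∀ k → + ψ k ℤ.- + n ≡ a ℤ.+ + k) →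
       sum (map g (map (λ k → + k ℤ.- + n) (applyUpTo ψ m))) ≡ sumFrom a m g
  go zero a ψ eq = refl
  go (suc m) a ψ eq = cong₂ _+_ (cong g (trans (eq 0) (ℤP.+-identityʳ a)))
    (go m (a ℤ.+ + 1) (λ k → ψ (suc k)) (λ k → trans (eq (suc k)) (sym (ℤP.+-assoc a (+ 1) (+ k)))))

count≡box : ∀ C n → count C n ≡ box n (λ v → χ (C v))
count≡box C n = begin
  count C n
    ≡⟨ sum-concatMap (λ i → map (λ j → if C (i , j) then 1 else 0) (range n)) (range n) ⟩
  sum (map (λ i → sum (map (λ j → if C (i , j) then 1 else 0) (range n))) (range n))
    ≡⟨ sum-range n _ ⟩
  sumFrom (corner n) (side n) (λ i → sum (map (λ j → if C (i , j) then 1 else 0) (range n)))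
    ≡⟨ sumFrom-cong (side n) (corner n) (λ i →
         trans (cong sum (map-cong (λ j → if≡χ (C (i , j))) (range n))) (sum-range n _)) ⟩
  box n (λ v → χ (C v)) ∎
  where
  open ≡-Reasoning
  if≡χ : ∀ b → (if b then 1 else 0) ≡ χ b
  if≡χ true = refl
  if≡χ false = refl

box-sum : ∀ {A : Set} n (G : A → V → ℕ) xs →
          box n (λ y → sum (map (λ s → G s y) xs)) ≡ sum (map (λ s → box n (G s)) xs)
box-sum n G [] = trans (box-const n 0) (trans (cong (_*_ (side n)) (*-zeroʳ (side n))) (*-zeroʳ (side n)))
box-sum n G (x ∷ xs) = trans (box-+ n (G x) _) (cong (_+_ (box n (G x))) (box-sum n G xs))

dir : Fin 6 → V
dir i = rot^ (toℕ i) (+ 1 , + 0)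

offsets : List V
offsets = origin ∷ tabulate dir

InN⇒offset : ∀ {u w} → InN u w → ∃[ s ] s ∈ offsets × w ≡ u +V s
InN⇒offset {u} (inj₁ refl) = origin , here refl , sym (+V-identityʳ u)
InN⇒offset {u} {w} (inj₂ adj) = negV (u -V w) , there (All.lookup steps-opposite adj) , w≡u+-[u-w] u w
  where
  steps-opposite : All (λ k → negV k ∈ tabulate dir) steps
  steps-opposite = from-yes (All.all? (λ k → negV k ∈? tabulate dir) steps)

offset⇒InN : ∀ u {s} → s ∈ offsets → InN u (u +V s)
offset⇒InN u (here refl) = inj₁ (+V-identityʳ u)
offset⇒InN u {s} (there s∈) = inj₂ (subst (_∈ steps) (sym (u-[u+s]≡-s u s)) (All.lookup dirs-opposite s∈))
  where
  dirs-opposite : All (λ s → negV s ∈ steps) (tabulate dir)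
  dirs-opposite = from-yes (All.all? (λ s → negV s ∈? steps) (tabulate dir))

SameI-sym : ∀ C u v → SameI C u v → SameI C v u
SameI-sym C u v same w = mk⇔ (Equivalence.from (same w)) (Equivalence.to (same w))

sizeI : Code → V → ℕ
sizeI C y = sum (map (λ s → χ (C (y +V s))) offsets)

sum-offsets-rot : ∀ g → sum (map (g ∘ rot) offsets) ≡ sum (map g offsets)
sum-offsets-rot g = rotate (g origin) (g (dir 0F)) (g (dir 1F)) (g (dir 2F)) (g (dir 3F)) (g (dir 4F)) (g (dir 5F))
  where
  rotate : ∀ o a b c d e f → o + (b + (c + (d + (e + (f + (a + 0)))))) ≡ o + (a + (b + (c + (d + (e + (f + 0))))))
  rotate = ℕ-Solver.solve-∀

sum-offsets-rot^ : ∀ k g → sum (map (g ∘ rot^ k) offsets) ≡ sum (map g offsets)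
sum-offsets-rot^ zero g = refl
sum-offsets-rot^ (suc k) g = trans (sum-offsets-rot^ k (g ∘ rot)) (sum-offsets-rot g)

sizeI-rot : ∀ C y → sizeI (C ∘ rot) y ≡ sizeI C (rot y)
sizeI-rot C y = trans (sum-map-cong offsets (λ s → cong (χ ∘ C) (rot-+V y s)))
                      (sum-offsets-rot (λ s → χ (C (rot y +V s))))

sizeI-rot^ : ∀ k C y → sizeI (C ∘ rot^ k) y ≡ sizeI C (rot^ k y)
sizeI-rot^ zero C y = refl
sizeI-rot^ (suc k) C y = trans (sizeI-rot^ k (C ∘ rot) y) (sizeI-rot C (rot^ k y))

sizeI-translate : ∀ C c y → sizeI C (c +V y) ≡ sizeI (λ z → C (c +V z)) y
sizeI-translate C c y = sum-map-cong offsets (λ s → cong (χ ∘ C) (+V-assoc c y s))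

sizeI-positive : ∀ C → IsCovering C → ∀ y → 1 ≤ sizeI C y
sizeI-positive C (_ , cover) y with cover y
... | w , w∈N , w∈C with InN⇒offset w∈N
... | s , s∈ , refl = subst (λ b → χ b ≤ sizeI C y) w∈C (sum-map-∈ (λ s → χ (C (y +V s))) s∈)

sizeI≤7 : ∀ C y → sizeI C y ≤ 7
sizeI≤7 C y = sum-map-mono offsets (λ s _ → χ≤1 (C (y +V s)))

-- Separating pairs of vertices

Covers : V → V → List V → Set
Covers u v Z = All (λ s → ((u +V s) -V v) ∈ offsets ⊎ (u +V s) ∈ Z) offsets

Separates : V → V → List V → Set
Separates u v Z = Adj u v × Covers u v Z × Covers v u Z

separates? : ∀ u v Z → Dec (Separates u v Z)
separates? u v Z = (u -V v ∈? steps) ×-dec covers? u v ×-dec covers? v u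
  where
  covers? : ∀ u v → Dec (Covers u v Z)
  covers? u v = All.all? (λ s → (((u +V s) -V v) ∈? offsets) ⊎-dec ((u +V s) ∈? Z)) offsets

Blank : Code → V → List V → Set
Blank C c Z = All (λ z → C (c +V z) ≡ false) Z

I-⊆-by-cover : ∀ C c {u v Z} → Covers u v Z → Blank C c Z → ∀ w → InI C (c +V u) w → InI C (c +V v) w
I-⊆-by-cover C c {u} {v} cover blank w (w∈N , w∈C) with InN⇒offset w∈N
... | s , s∈ , refl with All.lookup cover s∈
...   | inj₁ t∈ = subst (InN (c +V v)) moved (offset⇒InN (c +V v) t∈) , w∈C
  where
  moved : (c +V v) +V ((u +V s) -V v) ≡ (c +V u) +V s
  moved = trans ([c+v]+[k-v]≡c+k c v (u +V s)) (sym (+V-assoc c u s))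
...   | inj₂ z∈ with () ← trans (sym w∈C) (trans (cong C (+V-assoc c u s)) (All.lookup blank z∈))

sameI-by-cover : ∀ C c {u v Z} → Covers u v Z → Covers v u Z → Blank C c Z → SameI C (c +V u) (c +V v)
sameI-by-cover C c uv vu blank w = mk⇔ (I-⊆-by-cover C c uv blank w) (I-⊆-by-cover C c vu blank w)

blank-of-or : ∀ C c Zs → or (map (any (λ z → C (c +V z))) Zs) ≡ false → Blank C c (concat Zs)
blank-of-or C c [] _ = []
blank-of-or C c (Z ∷ Zs) eq =
  ++⁺ (blank-of-any Z (proj₁ (∨-false eq))) (blank-of-or C c Zs (proj₂ (∨-false eq)))
  where
  ∨-false : ∀ {x y} → x ∨ y ≡ false → x ≡ false × y ≡ false
  ∨-false {false} {false} _ = refl , refl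
  blank-of-any : ∀ Z → any (λ z → C (c +V z)) Z ≡ false → Blank C c Z
  blank-of-any [] _ = []
  blank-of-any (z ∷ Z) eq = proj₁ (∨-false eq) ∷ blank-of-any Z (proj₂ (∨-false eq))

separator-meets-code : ∀ C → IsLocalIdentifying C → ∀ c u v Zs → Separates u v (concat Zs) →
                       T (or (map (any (λ z → C (c +V z))) Zs))
separator-meets-code C (_ , local) c u v Zs (adj , uv , vu) with or (map (any (λ z → C (c +V z))) Zs) in eq
... | true = _
... | false = local (c +V u) (c +V v) (subst (_∈ steps) (sym ([c+u]-[c+v]≡u-v c u v)) adj)
                    (sameI-by-cover C c uv vu (blank-of-or C c Zs eq))

-- The charge received by a codeword

-- weight n = 420 / n for 1 ≤ n ≤ 7, where 420 = lcm (1, …, 7); the other values only keep weight antitone.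
weight : ℕ → ℕ
weight 0 = 420
weight 1 = 420
weight 2 = 210
weight 3 = 140
weight 4 = 105
weight 5 = 84
weight 6 = 70
weight _ = 60

weight-exact : ∀ n → 1 ≤ n → n ≤ 7 → n * weight n ≡ 420
weight-exact 1 _ _ = refl
weight-exact 2 _ _ = refl
weight-exact 3 _ _ = refl
weight-exact 4 _ _ = refl
weight-exact 5 _ _ = refl
weight-exact 6 _ _ = refl
weight-exact 7 _ _ = refl
weight-exact (suc (suc (suc (suc (suc (suc (suc (suc _)))))))) _ (s≤s (s≤s (s≤s (s≤s (s≤s (s≤s (s≤s ())))))))

antitone-by-step : (f : ℕ → ℕ) → (∀ n → f (suc n) ≤ f n) → ∀ {m n} → m ≤ n → f n ≤ f m
antitone-by-step f step {n = zero} z≤n = ≤-refl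
antitone-by-step f step {n = suc n} z≤n = ≤-trans (step n) (antitone-by-step f step z≤n)
antitone-by-step f step (s≤s m≤n) = antitone-by-step (f ∘ suc) (step ∘ suc) m≤n

weight-antitone : ∀ {m n} → m ≤ n → weight n ≤ weight m
weight-antitone = antitone-by-step weight step
  where
  step : ∀ n → weight (suc n) ≤ weight n
  step 0 = ≤-refl
  step 1 = ≤ᵇ⇒≤ 210 420 _
  step 2 = ≤ᵇ⇒≤ 140 210 _
  step 3 = ≤ᵇ⇒≤ 105 140 _
  step 4 = ≤ᵇ⇒≤ 84 105 _
  step 5 = ≤ᵇ⇒≤ 70 84 _
  step 6 = ≤ᵇ⇒≤ 60 70 _
  step (suc (suc (suc (suc (suc (suc (suc _))))))) = ≤-refl

-- 420 times the total charge that the vertex z receives from its closed neighbourhood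
share : Code → V → ℕ
share C z = sum (map (λ s → weight (sizeI C (z +V s))) offsets)

share-translate : ∀ C c → share C c ≡ share (λ z → C (c +V z)) origin
share-translate C c = sum-map-cong offsets (λ s →
  cong weight (trans (sizeI-translate C c s) (cong (sizeI (λ z → C (c +V z))) (sym (+V-identity-left s)))))
  where
  +V-identity-left : ∀ u → origin +V u ≡ u
  +V-identity-left (a , b) = cong₂ _,_ (ℤP.+-identityˡ a) (ℤP.+-identityˡ b)

next : Fin 6 → Fin 6
next 0F = 1F
next 1F = 2F
next 2F = 3F
next 3F = 4F
next 4F = 5F
next 5F = 0F

_⊕_ : Fin 6 → ℕ → Fin 6
i ⊕ zero = i
i ⊕ suc k = next (i ⊕ k)

rot^-dir : ∀ i j → rot^ (toℕ i) (dir j) ≡ dir (i ⊕ toℕ j)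
rot^-dir = from-yes (all? λ i → all? λ j → rot^ (toℕ i) (dir j) ≟V dir (i ⊕ toℕ j))

-- N[dir i] minus N[origin]
outer : Fin 6 → List V
outer i = map (rot^ (toℕ i)) ((+ 2 , + 0) ∷ (+ 2 , + 1) ∷ (+ 1 , -[1+ 0 ]) ∷ [])

centre-separator neighbour-separator : Fin 6 → List (List V)
centre-separator i = outer i ∷ map dir (i ⊕ 2 ∷ i ⊕ 3 ∷ i ⊕ 4 ∷ []) ∷ []
neighbour-separator i = outer i ∷ outer (i ⊕ 1) ∷ map dir (i ⊕ 5 ∷ i ⊕ 2 ∷ []) ∷ []

centre-separates : ∀ i → Separates origin (dir i) (concat (centre-separator i))
centre-separates = from-yes (all? λ i → separates? origin (dir i) (concat (centre-separator i)))

neighbour-separates : ∀ i → Separates (dir i) (dir (i ⊕ 1)) (concat (neighbour-separator i))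
neighbour-separates = from-yes (all? λ i → separates? (dir i) (dir (i ⊕ 1)) (concat (neighbour-separator i)))

neighbour-lower-bound₀ : ∀ L → L origin ≡ true →
  1 + χ (L (dir 5F)) + χ (L (dir 0F)) + χ (L (dir 1F)) + χ (any L (outer 0F)) ≤ sizeI L (dir 0F)
neighbour-lower-bound₀ L L0 rewrite L0 =
  ≤-trans (+-monoʳ-≤ (1 + χ (L (dir 5F)) + χ (L (dir 0F)) + χ (L (dir 1F))) (χ-or₃ x y z))
          (≤-reflexive (rearrange (χ (L (dir 5F))) (χ (L (dir 0F))) (χ (L (dir 1F))) (χ x) (χ y) (χ z)))
  where
  x = L (+ 2 , + 0)
  y = L (+ 2 , + 1)
  z = L (+ 1 , -[1+ 0 ])
  χ-or₃ : ∀ x y z → χ (x ∨ (y ∨ (z ∨ false))) ≤ χ x + χ y + χ z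
  χ-or₃ true y z = s≤s z≤n
  χ-or₃ false true z = s≤s z≤n
  χ-or₃ false false true = s≤s z≤n
  χ-or₃ false false false = z≤n
  rearrange : ∀ e a d x y z → 1 + e + a + d + (x + y + z) ≡ a + (x + (y + (d + (1 + (e + (z + 0))))))
  rearrange = ℕ-Solver.solve-∀

-- b i: dir i is a codeword; p i: outer i meets the code.
neighbourSize : (b p : Fin 6 → Bool) → Fin 6 → ℕ
neighbourSize b p i = 1 + χ (b (i ⊕ 5)) + χ (b i) + χ (b (i ⊕ 1)) + χ (p i)

-- A general neighbour is the neighbour dir 0F of the rotated code.
neighbour-lower-bound : ∀ L → L origin ≡ true → ∀ i → neighbourSize (L ∘ dir) (any L ∘ outer) i ≤ sizeI L (dir i)
neighbour-lower-bound L L0 i =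
  subst₂ (λ u v → 1 + χ (L u) + χ (L (dir i)) + χ (L v) + χ (any L (outer i)) ≤ sizeI L (dir i))
         (rot^-dir i 5F) (rot^-dir i 1F)
         (≤-trans (neighbour-lower-bound₀ (L ∘ rot^ (toℕ i)) (trans (cong L (rot^-origin (toℕ i))) L0))
                  (≤-reflexive (sizeI-rot^ (toℕ i) L (dir 0F))))

-- Shaped like or (map (any L) Zs) for the separators above, so that separator-meets-code fits without rewriting.
Separated : (b p : Fin 6 → Bool) → Fin 6 → Bool
Separated b p i = or (p i ∷ any b (i ⊕ 2 ∷ i ⊕ 3 ∷ i ⊕ 4 ∷ []) ∷ [])
                ∧ or (p i ∷ p (i ⊕ 1) ∷ any b (i ⊕ 5 ∷ i ⊕ 2 ∷ []) ∷ [])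

charge : (b p : Fin 6 → Bool) → ℕ
charge b p = weight (1 + sum (map (χ ∘ b) (allFin 6))) + sum (map (weight ∘ neighbourSize b p) (allFin 6))

allVec : ∀ n → (Vec Bool n → Bool) → Bool
allVec zero P = P []ᵛ
allVec (suc n) P = allVec n (λ v → P (true ∷ᵛ v)) ∧ allVec n (λ v → P (false ∷ᵛ v))

allVec-sound : ∀ n P → T (allVec n P) → ∀ v → T (P v)
allVec-sound zero P t []ᵛ = t
allVec-sound (suc n) P t (true ∷ᵛ v) = allVec-sound n _ (proj₁ (Equivalence.to T-∧ t)) v
allVec-sound (suc n) P t (false ∷ᵛ v) = allVec-sound n _ (proj₂ (Equivalence.to (T-∧ {allVec n _}) t)) v

charge-bound : ∀ b p → T (all (Separated b p) (allFin 6)) → charge b p ≤ 1680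
charge-bound b p separated = ≤ᵇ⇒≤ _ _ (modus-ponens valid separated)
  where
  modus-ponens : ∀ {x y} → T (not x ∨ y) → T x → T y
  modus-ponens {true} t _ = t
  Valid : (b p : Fin 6 → Bool) → Bool
  Valid b p = not (all (Separated b p) (allFin 6)) ∨ (charge b p ≤ᵇ 1680)
  valid : T (Valid b p)
  valid = allVec-sound 6 (Valid (lookup (tabulateᵛ b)) ∘ lookup)
            (allVec-sound 6 (λ v → allVec 6 (Valid (lookup v) ∘ lookup)) _ (tabulateᵛ b)) (tabulateᵛ p)

share-bound : ∀ C → IsLocalIdentifying C → ∀ c → C c ≡ true → share C c ≤ 1680
share-bound C lid c c∈C = begin
  share C c        ≡⟨ share-translate C c ⟩
  share L origin   ≤⟨ +-mono-≤ centre neighbours ⟩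
  charge b p       ≤⟨ charge-bound b p (all⁻ (Separated b p) (tabulate⁺ {P = T ∘ Separated b p} {f = λ i → i}
                                                                           separated)) ⟩
  1680             ∎
  where
  open ≤-Reasoning
  L : Code
  L z = C (c +V z)
  L0 : L origin ≡ true
  L0 = trans (cong C (+V-identityʳ c)) c∈C
  b p : Fin 6 → Bool
  b i = L (dir i)
  p i = any L (outer i)
  centre : weight (sizeI L origin) ≤ weight (1 + sum (map (χ ∘ b) (allFin 6)))
  centre rewrite L0 = ≤-refl
  neighbours : sum (map (λ i → weight (sizeI L (dir i))) (allFin 6))
             ≤ sum (map (weight ∘ neighbourSize b p) (allFin 6))
  neighbours = sum-map-mono (allFin 6) (λ i _ → weight-antitone (neighbour-lower-bound L L0 i))
  separated : ∀ i → T (Separated b p i)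
  separated i = Equivalence.from T-∧
    ( separator-meets-code C lid c origin (dir i) (centre-separator i) (centre-separates i)
    , separator-meets-code C lid c (dir i) (dir (i ⊕ 1)) (neighbour-separator i) (neighbour-separates i))

offsets-small : All (λ s → Small (proj₁ s) × Small (proj₂ s)) offsets
offsets-small = (nil , nil) ∷ (pos , nil) ∷ (pos , pos) ∷ (nil , pos)
              ∷ (neg , nil) ∷ (neg , neg) ∷ (nil , neg) ∷ []

-- Every vertex of Q_n spreads a total charge of 420 over the codewords of its closed neighbourhood, which lie
-- in Q_(n+1).
redistribute : ∀ C → IsCovering C → ∀ n → box n (λ _ → 420) ≤ box (suc n) (λ z → χ (C z) * share C z)
redistribute C covering n = begin
  box n (λ _ → 420)
    ≡⟨ box-cong n (λ y → sym (weight-exact (sizeI C y) (sizeI-positive C covering y) (sizeI≤7 C y))) ⟩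
  box n (λ y → sizeI C y * weight (sizeI C y))
    ≡⟨ box-cong n (λ y → sum-map-*ʳ (λ s → χ (C (y +V s))) offsets (weight (sizeI C y))) ⟩
  box n (λ y → sum (map (λ s → G s y) offsets))
    ≡⟨ box-sum n G offsets ⟩
  sum (map (λ s → box n (G s)) offsets)
    ≤⟨ sum-map-mono offsets (λ s s∈ → shifted s (All.lookup offsets-small s∈)) ⟩
  sum (map ((λ t → box (suc n) (K t)) ∘ rot^ 3) offsets)
    ≡⟨ sum-offsets-rot^ 3 (λ t → box (suc n) (K t)) ⟩
  sum (map (λ t → box (suc n) (K t)) offsets)
    ≡⟨ box-sum (suc n) K offsets ⟨
  box (suc n) (λ z → sum (map (λ t → K t z) offsets))
    ≡⟨ box-cong (suc n) (λ z → sum-map-*ˡ (λ t → weight (sizeI C (z +V t))) offsets (χ (C z))) ⟨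
  box (suc n) (λ z → χ (C z) * share C z) ∎
  where
  open ≤-Reasoning
  G K : V → V → ℕ
  G s y = χ (C (y +V s)) * weight (sizeI C y)
  K t z = χ (C z) * weight (sizeI C (z +V t))
  shifted : ∀ s → Small (proj₁ s) × Small (proj₂ s) → box n (G s) ≤ box (suc n) (K (rot^ 3 s))
  shifted s@(d₁ , d₂) (small₁ , small₂) =
    ≤-trans (≤-reflexive (box-cong n λ y →
               cong (λ u → χ (C (y +V s)) * weight (sizeI C u)) (sym ([u+v]+rot³v≡u y s))))
            (box-shift n (K (rot^ 3 s)) d₁ d₂ small₁ small₂)

lower-count : ∀ C → IsLocalIdentifying C → ∀ n → side n * side n ≤ 4 * count C (suc n)
lower-count C lid n = *-cancelˡ-≤ 420 (begin
  420 * (side n * side n)                  ≡⟨ trans (*-comm 420 _) (*-assoc (side n) (side n) 420) ⟩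
  side n * (side n * 420)                  ≡⟨ box-const n 420 ⟨
  box n (λ _ → 420)                        ≤⟨ redistribute C (proj₁ lid) n ⟩
  box (suc n) (λ z → χ (C z) * share C z)  ≤⟨ box-mono (suc n) codeword-bound ⟩
  box (suc n) (λ z → 1680 * χ (C z))       ≡⟨ box-* (suc n) 1680 (λ z → χ (C z)) ⟩
  1680 * box (suc n) (λ z → χ (C z))       ≡⟨ cong (_*_ 1680) (count≡box C (suc n)) ⟨
  1680 * count C (suc n)                   ≡⟨ *-assoc 420 4 (count C (suc n)) ⟩
  420 * (4 * count C (suc n))              ∎)
  where
  open ≤-Reasoning
  codeword-bound : ∀ z → χ (C z) * share C z ≤ 1680 * χ (C z)
  codeword-bound z with C z in z∈C
  ... | true = ≤-trans (≤-reflexive (+-identityʳ (share C z))) (share-bound C lid z z∈C)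
  ... | false = z≤n

-- An identifying code of density 1/4

isEvenℕ : ℕ → Bool
isEvenℕ zero = true
isEvenℕ (suc n) = not (isEvenℕ n)

isEven : ℤ → Bool
isEven (+ n) = isEvenℕ n
isEven -[1+ n ] = not (isEvenℕ n)

isEven-suc : ∀ a → isEven (a ℤ.+ + 1) ≡ not (isEven a)
isEven-suc (+ n) = cong isEvenℕ (+-comm n 1)
isEven-suc -[1+ zero ] = refl
isEven-suc -[1+ suc n ] = sym (not-involutive (not (isEvenℕ n)))

isEven-pred : ∀ a → isEven (a ℤ.+ -[1+ 0 ]) ≡ not (isEven a)
isEven-pred a =
  trans (sym (not-involutive _)) (cong not (trans (sym (isEven-suc (a ℤ.+ -[1+ 0 ]))) (cong isEven (back a))))
  where
  back : ∀ a → (a ℤ.+ -[1+ 0 ]) ℤ.+ + 1 ≡ a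
  back = solve-∀

isEven-+0 : ∀ a → isEven (a ℤ.+ + 0) ≡ isEven a
isEven-+0 a = cong isEven (ℤP.+-identityʳ a)

flipped : ∀ {x y} → x ≡ not y → y ≡ false → x ≡ true
flipped eq refl = eq

C₀ : Code
C₀ (i , j) = isEven i ∧ isEven j

∧-true : ∀ {x y} → x ∧ y ≡ true → x ≡ true × y ≡ true
∧-true {true} eq = refl , eq

parity-clash : ∀ a δ → isEven (a ℤ.+ δ) ≡ not (isEven a) → isEven a ≡ true → isEven (a ℤ.+ δ) ≡ true → ⊥
parity-clash a δ flip a-even aδ-even with () ← trans (sym aδ-even) (trans flip (cong not a-even))

C₀-independent : ∀ v {s} → s ∈ offsets → C₀ v ≡ true → C₀ (v +V s) ≡ true → s ≡ origin
C₀-independent v (here refl) _ _ = refl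
C₀-independent (i , j) (there (here refl)) v∈ w∈ =
  ⊥-elim (parity-clash i _ (isEven-suc i) (proj₁ (∧-true v∈)) (proj₁ (∧-true w∈)))
C₀-independent (i , j) (there (there (here refl))) v∈ w∈ =
  ⊥-elim (parity-clash i _ (isEven-suc i) (proj₁ (∧-true v∈)) (proj₁ (∧-true w∈)))
C₀-independent (i , j) (there (there (there (here refl)))) v∈ w∈ =
  ⊥-elim (parity-clash j _ (isEven-suc j) (proj₂ (∧-true {isEven i} v∈)) (proj₂ (∧-true {isEven (i ℤ.+ + 0)} w∈)))
C₀-independent (i , j) (there (there (there (there (here refl))))) v∈ w∈ =
  ⊥-elim (parity-clash i _ (isEven-pred i) (proj₁ (∧-true v∈)) (proj₁ (∧-true w∈)))
C₀-independent (i , j) (there (there (there (there (there (here refl)))))) v∈ w∈ =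
  ⊥-elim (parity-clash i _ (isEven-pred i) (proj₁ (∧-true v∈)) (proj₁ (∧-true w∈)))
C₀-independent (i , j) (there (there (there (there (there (there (here refl))))))) v∈ w∈ =
  ⊥-elim (parity-clash j _ (isEven-pred j) (proj₂ (∧-true {isEven i} v∈)) (proj₂ (∧-true {isEven (i ℤ.+ + 0)} w∈)))

-- Two vertices of N[v] whose difference is 2d determine v.
Pinned : V → Set
Pinned d = All (λ s → All (λ t → d -V s ≡ negV d -V t → d -V s ≡ origin) offsets) offsets

pinned? : ∀ d → Dec (Pinned d)
pinned? d = All.all? (λ s → All.all? (λ t → ((d -V s) ≟V (negV d -V t)) →-dec ((d -V s) ≟V origin))
                                         offsets) offsets

midpoint-unique : ∀ C u v d → d ∈ offsets → negV d ∈ offsets → Pinned d →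
                  C (u +V d) ≡ true → C (u +V negV d) ≡ true → SameI C u v → v ≡ u
midpoint-unique C u v d d∈ -d∈ pinned u+d∈C u-d∈C same
  with InN⇒offset (proj₁ (Equivalence.to (same (u +V d)) (offset⇒InN u d∈ , u+d∈C)))
     | InN⇒offset (proj₁ (Equivalence.to (same (u +V negV d)) (offset⇒InN u -d∈ , u-d∈C)))
... | s , s∈ , eq₁ | t , t∈ , eq₂ =
  trans v≡u+d-s (trans (cong (u +V_) (All.lookup (All.lookup pinned s∈) t∈ d-s≡-d-t)) (+V-identityʳ u))
  where
  v≡u+d-s : v ≡ u +V (d -V s)
  v≡u+d-s = u+d≡v+s⇒v≡u+[d-s] u d v s eq₁
  d-s≡-d-t : d -V s ≡ negV d -V t
  d-s≡-d-t = +V-cancelˡ u _ _ (trans (sym v≡u+d-s) (u+d≡v+s⇒v≡u+[d-s] u (negV d) v t eq₂))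

data C₀-position (u : V) : Set where
  codeword : C₀ u ≡ true → C₀-position u
  midpoint : ∀ d → d ∈ offsets → negV d ∈ offsets → Pinned d →
             C₀ (u +V d) ≡ true → C₀ (u +V negV d) ≡ true → C₀-position u

straddle : ∀ {u} d → {True (d ∈? offsets)} → {True (negV d ∈? offsets)} → {True (pinned? d)} →
           C₀ (u +V d) ≡ true → C₀ (u +V negV d) ≡ true → C₀-position u
straddle d {d∈} { -d∈} {pinned} = midpoint d (toWitness d∈) (toWitness -d∈) (toWitness pinned)

C₀-classify : ∀ u → C₀-position u
C₀-classify (i , j) with isEven i in ei | isEven j in ej
... | true | true = codeword (cong₂ _∧_ ei ej)
... | false | true = straddle (+ 1 , + 0)
  (cong₂ _∧_ (flipped (isEven-suc i) ei) (trans (isEven-+0 j) ej))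
  (cong₂ _∧_ (flipped (isEven-pred i) ei) (trans (isEven-+0 j) ej))
... | true | false = straddle (+ 0 , + 1)
  (cong₂ _∧_ (trans (isEven-+0 i) ei) (flipped (isEven-suc j) ej))
  (cong₂ _∧_ (trans (isEven-+0 i) ei) (flipped (isEven-pred j) ej))
... | false | false = straddle (+ 1 , + 1)
  (cong₂ _∧_ (flipped (isEven-suc i) ei) (flipped (isEven-suc j) ej))
  (cong₂ _∧_ (flipped (isEven-pred i) ei) (flipped (isEven-pred j) ej))

codewords-unique : ∀ u v → C₀ u ≡ true → C₀ v ≡ true → SameI C₀ u v → v ≡ u
codewords-unique u v u∈ v∈ same with InN⇒offset (proj₁ (Equivalence.to (same u) (inj₁ refl , u∈)))
... | s , s∈ , eq =
  sym (trans eq (trans (cong (v +V_) (C₀-independent v s∈ v∈ (subst (λ w → C₀ w ≡ true) eq u∈))) (+V-identityʳ v)))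

C₀-identifying : IsIdentifying C₀
C₀-identifying = ((origin , refl) , covering) , separating
  where
  covering : ∀ u → ∃ λ w → InI C₀ u w
  covering u with C₀-classify u
  ... | codeword u∈ = u , inj₁ refl , u∈
  ... | midpoint d d∈ _ _ u+d∈ _ = u +V d , offset⇒InN u d∈ , u+d∈
  separating : ∀ u v → ¬ u ≡ v → ¬ SameI C₀ u v
  separating u v u≢v same with C₀-classify u | C₀-classify v
  ... | midpoint d d∈ -d∈ pinned u+d∈ u-d∈ | _ = u≢v (sym (midpoint-unique C₀ u v d d∈ -d∈ pinned u+d∈ u-d∈ same))
  ... | codeword _ | midpoint d d∈ -d∈ pinned v+d∈ v-d∈ =
    u≢v (midpoint-unique C₀ v u d d∈ -d∈ pinned v+d∈ v-d∈ (SameI-sym C₀ u v same))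
  ... | codeword u∈ | codeword v∈ = u≢v (sym (codewords-unique u v u∈ v∈ same))

identifying⇒local : ∀ C → IsIdentifying C → IsLocalIdentifying C
identifying⇒local C (covering , separating) = covering , λ u v adj → separating u v (λ { refl → irreflexive u adj })
  where
  irreflexive : ∀ u → ¬ Adj u u
  irreflexive (a , b) adj = from-no (origin ∈? steps) (subst (_∈ steps) (cong₂ _,_ (self a) (self b)) adj)
    where
    self : ∀ a → a ℤ.- a ≡ + 0
    self = solve-∀

evens-in-window : ∀ m a → sumFrom a (suc (m + m)) (χ ∘ isEven) ≤ suc m
evens-in-window zero a = ≤-trans (≤-reflexive (+-identityʳ _)) (χ≤1 (isEven a))
evens-in-window (suc m) a = begin
  χ (isEven a) + (χ (isEven (a ℤ.+ + 1)) + sumFrom a″ (m + suc m) (χ ∘ isEven))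
    ≡⟨ +-assoc (χ (isEven a)) _ _ ⟨
  (χ (isEven a) + χ (isEven (a ℤ.+ + 1))) + sumFrom a″ (m + suc m) (χ ∘ isEven)
    ≡⟨ cong₂ _+_ (trans (cong (λ x → χ (isEven a) + χ x) (isEven-suc a)) (χ-not (isEven a)))
                 (cong (λ k → sumFrom a″ k (χ ∘ isEven)) (+-suc m m)) ⟩
  1 + sumFrom a″ (suc (m + m)) (χ ∘ isEven)
    ≤⟨ s≤s (evens-in-window m a″) ⟩
  suc (suc m) ∎
  where
  open ≤-Reasoning
  a″ = (a ℤ.+ + 1) ℤ.+ + 1
  χ-not : ∀ x → χ x + χ (not x) ≡ 1
  χ-not true = refl
  χ-not false = refl

C₀-count : ∀ n → count C₀ n ≤ suc n * suc n
C₀-count n = begin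
  count C₀ n
    ≡⟨ count≡box C₀ n ⟩
  box n (χ ∘ C₀)
    ≡⟨ sumFrom-cong (side n) (corner n) (λ i → trans (sumFrom-cong (side n) (corner n) (λ j → χ-∧ (isEven i) (isEven j)))
                                                     (sumFrom-* (side n) (corner n) (χ (isEven i)) (χ ∘ isEven))) ⟩
  sumFrom (corner n) (side n) (λ i → χ (isEven i) * evens)
    ≡⟨ sumFrom-cong (side n) (corner n) (λ i → *-comm (χ (isEven i)) evens) ⟩
  sumFrom (corner n) (side n) (λ i → evens * χ (isEven i))
    ≡⟨ sumFrom-* (side n) (corner n) evens (χ ∘ isEven) ⟩
  evens * evens
    ≤⟨ *-mono-≤ (evens-in-window n (corner n)) (evens-in-window n (corner n)) ⟩
  suc n * suc n ∎
  where
  open ≤-Reasoning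
  evens = sumFrom (corner n) (side n) (χ ∘ isEven)
  χ-∧ : ∀ x y → χ (x ∧ y) ≡ χ x * χ y
  χ-∧ true y = sym (+-identityʳ (χ y))
  χ-∧ false y = refl

ratio≃ : ∀ c q → ℚ.toℚᵘ ((+ c) ℚ./ suc q) ℚᵘ.≃ mkℚᵘ (+ c) q
ratio≃ c q = ℚP.toℚᵘ-fromℚᵘ (mkℚᵘ (+ c) q)

-- ε = (a + 1) / (d + 1) in lowest terms and the ratio is c / (q + 1).
quarter-ε<ratio : ∀ c q a d .(cop : Coprime (suc a) (suc d)) →
  suc d * suc q < c * (4 * suc d) + 4 * suc a * suc q → quarter ℚ.- mkℚ +[1+ a ] d cop ℚ.< (+ c) ℚ./ suc q
quarter-ε<ratio c q a d cop cross = ℚP.toℚᵘ-cancel-<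
  (ℚᵘP.<-respˡ-≃ (ℚᵘP.≃-sym difference≃) (ℚᵘP.<-respʳ-≃ (ℚᵘP.≃-sym (ratio≃ c q)) unnormalised))
  where
  ε = mkℚ +[1+ a ] d cop
  difference≃ : ℚ.toℚᵘ (quarter ℚ.- ε) ℚᵘ.≃ (mkℚᵘ (+ 1) 3 ℚᵘ.- mkℚᵘ +[1+ a ] d)
  difference≃ = ℚᵘP.≃-trans (ℚP.toℚᵘ-homo-+ quarter (ℚ.- ε))
                            (ℚᵘP.+-congʳ (mkℚᵘ (+ 1) 3) (ℚP.toℚᵘ-homo‿- ε))
  expand : ∀ D A Q → (+ 1 ℤ.* D ℤ.+ ℤ.- A ℤ.* + 4) ℤ.* Q ≡ D ℤ.* Q ℤ.- + 4 ℤ.* A ℤ.* Q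
  expand = solve-∀
  move : ∀ x y z → x ℤ.< y ℤ.+ z → x ℤ.- z ℤ.< y
  move x y z lt = subst (x ℤ.- z ℤ.<_) (cancel y z) (ℤP.+-monoˡ-< (ℤ.- z) lt)
    where
    cancel : ∀ y z → y ℤ.+ z ℤ.- z ≡ y
    cancel = solve-∀
  unnormalised : (mkℚᵘ (+ 1) 3 ℚᵘ.- mkℚᵘ +[1+ a ] d) ℚᵘ.< mkℚᵘ (+ c) q
  unnormalised = ℚᵘ.*<* (subst₂ ℤ._<_
    (trans (cong₂ ℤ._-_ (ℤP.pos-* (suc d) (suc q))
                        (trans (ℤP.pos-* (4 * suc a) (suc q)) (cong (ℤ._* + suc q) (ℤP.pos-* 4 (suc a)))))
           (sym (expand (+ suc d) (+ suc a) (+ suc q))))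
    (ℤP.pos-* c (4 * suc d))
    (move (+ (suc d * suc q)) (+ (c * (4 * suc d))) (+ (4 * suc a * suc q)) (+<+ cross)))

ratio<quarter+ε : ∀ c q a d .(cop : Coprime (suc a) (suc d)) →
  c * (4 * suc d) < suc d * suc q + 4 * suc a * suc q → (+ c) ℚ./ suc q ℚ.< quarter ℚ.+ mkℚ +[1+ a ] d cop
ratio<quarter+ε c q a d cop cross = ℚP.toℚᵘ-cancel-<
  (ℚᵘP.<-respʳ-≃ (ℚᵘP.≃-sym (ℚP.toℚᵘ-homo-+ quarter (mkℚ +[1+ a ] d cop)))
    (ℚᵘP.<-respˡ-≃ (ℚᵘP.≃-sym (ratio≃ c q)) unnormalised))
  where
  expand : ∀ D A Q → (+ 1 ℤ.* D ℤ.+ A ℤ.* + 4) ℤ.* Q ≡ D ℤ.* Q ℤ.+ + 4 ℤ.* A ℤ.* Q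
  expand = solve-∀
  unnormalised : mkℚᵘ (+ c) q ℚᵘ.< (mkℚᵘ (+ 1) 3 ℚᵘ.+ mkℚᵘ +[1+ a ] d)
  unnormalised = ℚᵘ.*<* (subst₂ ℤ._<_
    (ℤP.pos-* c (4 * suc d))
    (trans (trans (ℤP.pos-+ (suc d * suc q) _)
                  (cong₂ ℤ._+_ (ℤP.pos-* (suc d) (suc q))
                               (trans (ℤP.pos-* (4 * suc a) (suc q)) (cong (ℤ._* + suc q) (ℤP.pos-* 4 (suc a))))))
           (sym (expand (+ suc d) (+ suc a) (+ suc q))))
    (+<+ cross))

Qsize-suc : ∀ m → Qsize (suc m) ≡ suc (suc (side m)) * suc (suc (side m))
Qsize-suc = expand
  where
  expand : ∀ m → suc (4 * suc m * suc m + 4 * suc m) ≡ suc (suc (suc (m + m))) * suc (suc (suc (m + m)))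
  expand = ℕ-Solver.solve-∀

lower-cross : ∀ m D a c → D ≤ m → side m * side m ≤ 4 * c →
  D * Qsize (suc m) < c * (4 * D) + 4 * suc a * Qsize (suc m)
lower-cross m D a c D≤m k²≤4c = subst (λ Q → D * Q < c * (4 * D) + 4 * suc a * Q) (sym (Qsize-suc m))
  (subst (_< c * (4 * D) + 4 * suc a * Q) (sym (square-expand D k))
         (+-mono-≤-< scaled-hypothesis (begin-strict
            4 * (D * suc k)   <⟨ *-monoʳ-< 4 (≤-<-trans (*-monoˡ-≤ (suc k) D≤sk) (square-gap k)) ⟩
            4 * Q             ≤⟨ *-monoʳ-≤ 4 (m≤m+n Q (a * Q)) ⟩
            4 * (suc a * Q)   ≡⟨ *-assoc 4 (suc a) Q ⟨
            4 * suc a * Q     ∎)))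
  where
  open ≤-Reasoning
  k = side m
  Q = suc (suc k) * suc (suc k)
  square-expand : ∀ D k → D * (suc (suc k) * suc (suc k)) ≡ D * (k * k) + 4 * (D * suc k)
  square-expand = ℕ-Solver.solve-∀
  square-gap : ∀ k → suc k * suc k < suc (suc k) * suc (suc k)
  square-gap k = subst (suc k * suc k <_) (expand k) (s≤s (m≤m+n _ _))
    where
    expand : ∀ k → suc (suc k * suc k + suc (suc (k + k))) ≡ suc (suc k) * suc (suc k)
    expand = ℕ-Solver.solve-∀
  scaled-hypothesis : D * (k * k) ≤ c * (4 * D)
  scaled-hypothesis = ≤-trans (*-monoʳ-≤ D k²≤4c) (≤-reflexive (commute D c))
    where
    commute : ∀ D c → D * (4 * c) ≡ c * (4 * D)
    commute = ℕ-Solver.solve-∀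
  D≤sk : D ≤ suc k
  D≤sk = ≤-trans D≤m (≤-trans (m≤m+n m m) (≤-trans (n≤1+n _) (n≤1+n _)))

upper-cross : ∀ n D a c → D ≤ n → c ≤ suc n * suc n →
  c * (4 * D) < D * Qsize n + 4 * suc a * Qsize n
upper-cross n D a c D≤n c≤ = begin-strict
  c * (4 * D)                       ≤⟨ *-monoˡ-≤ (4 * D) c≤ ⟩
  suc n * suc n * (4 * D)           ≡⟨ expand n D ⟩
  D * Q + D * (4 * n + 3)           <⟨ +-monoʳ-< (D * Q) (begin-strict
    D * (4 * n + 3)                 ≤⟨ *-monoˡ-≤ (4 * n + 3) D≤n ⟩
    n * (4 * n + 3)                 <⟨ s≤s (m≤m+n _ _) ⟩
    suc (n * (4 * n + 3) + (12 * n * n + 13 * n + 3)) ≡⟨ four-Q n ⟨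
    4 * Q                           ≤⟨ *-monoʳ-≤ 4 (m≤m+n Q (a * Q)) ⟩
    4 * (suc a * Q)                 ≡⟨ *-assoc 4 (suc a) Q ⟨
    4 * suc a * Q                   ∎) ⟩
  D * Q + 4 * suc a * Q             ∎
  where
  open ≤-Reasoning
  Q = Qsize n
  expand : ∀ n D → suc n * suc n * (4 * D) ≡ D * suc (4 * n * n + 4 * n) + D * (4 * n + 3)
  expand = ℕ-Solver.solve-∀
  four-Q : ∀ n → 4 * suc (4 * n * n + 4 * n) ≡ suc (n * (4 * n + 3) + (12 * n * n + 13 * n + 3))
  four-Q = ℕ-Solver.solve-∀

density-lower : ∀ C → IsLocalIdentifying C → DensityGeq C quarter
density-lower C lid (mkℚ +[1+ a ] d cop) _ N =
  suc m , ≤-trans (m≤m+n N (suc d)) (n≤1+n _) ,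
  quarter-ε<ratio (count C (suc m)) _ a d cop
    (lower-cross m (suc d) a (count C (suc m)) (m≤n+m (suc d) N) (lower-count C lid m))
  where
  m = N + suc d
density-lower C lid (mkℚ (+ 0) d cop) (*<* (+<+ ())) N
density-lower C lid (mkℚ -[1+ a ] d cop) (*<* ()) N

density-upper : DensityLeq C₀ quarter
density-upper (mkℚ +[1+ a ] d cop) _ =
  suc d , λ n D≤n →
    ratio<quarter+ε (count C₀ n) _ a d cop (upper-cross n (suc d) a (count C₀ n) D≤n (C₀-count n))
density-upper (mkℚ (+ 0) d cop) (*<* (+<+ ()))
density-upper (mkℚ -[1+ a ] d cop) (*<* ())

mainTheorem18 : SmallestDensity IsLocalIdentifying quarter × SmallestDensity IsIdentifying quarter
mainTheorem18 =
  ((C₀ , C₀-local , C₀-density) , density-lower) ,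
  ((C₀ , C₀-identifying , C₀-density) , λ C identifying → density-lower C (identifying⇒local C identifying))
  where
  C₀-local = identifying⇒local C₀ C₀-identifying
  C₀-density = density-upper , density-lower C₀ C₀-local
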